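{- Let $m,h$ be positive integers and $k\ge2$ an integer. Then $\mathrm{capt}_{\zeta,k}(\mathcal{T}_m^h)\le h\left\lceil\frac{m-1}{k}\right\rceil$.
   Context: The perfect $m$-ary tree $\mathcal{T}_m^h$ of height $h$ is the rooted tree with levels $0,1,\dots,h$, where level $0$ is the root, and every vertex in levels $0,\dots,h-1$ has exactly $m$ children in the next level. The localization game on a connected graph $G$ with $k$ cops: the robber, invisible to the cops, first chooses a starting vertex. In each round the cops choose a multiset of vertices $u_1,\dots,u_k$ (no adjacency restriction) and learn the distances $d(u_i,R)$ to the robber's current vertex $R$; the cops capture the robber if, from all information so far, they can determine the robber's vertex uniquely. If not captured, the robber moves to a neighbor or stays. The robber is omniscient. The localization number $\zeta(G)$ is the least number of cops guaranteeing capture (trees have $\zeta\le2$). For $k\ge\zeta(G)$, $\mathrm{capt}_{\zeta,k}(G)$ is the minimum number of rounds in which $k$ cops can guarantee capture under optimal play. -}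

module Defs where

open import Data.Nat using (ℕ; zero; suc; _+_; _∸_; _*_; _<_; _≤_)
open import Data.Nat.DivMod using (_/_)
open import Data.Fin using (Fin)
open import Data.Fin.Properties using () renaming (_≟_ to _≟ᶠ_)
open import Data.List using (List; []; _∷_; length; _++_; [_])
open import Data.Vec using (Vec)
import Data.Vec as Vec
open import Data.Product using (Σ; ∃; ∃-syntax; _×_; _,_; proj₁)
open import Data.Sum using (_⊎_)
open import Relation.Nullary using (yes; no)
open import Relation.Binary.PropositionalEquality using (_≡_)
open import Level using (0ℓ) renaming (suc to lsuc)

-- Ceiling division: ⌈ a / b ⌉ for b ≥ 1 (value at b = 0 is irrelevant).

ceilDiv : ℕ → ℕ → ℕ
ceilDiv a zero    = zero
ceilDiv a (suc b) = (a + b) / suc b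

record Graph : Set₁ where
  field
    Vertex : Set
    _≈_    : Vertex → Vertex → Set
    Move   : Vertex → Vertex → Set      -- u = v or u adjacent to v
    dist   : Vertex → Vertex → ℕ

module Game (G : Graph) (k : ℕ) where
  open Graph G

  -- One round of observations: the k distances d(u_i, R).
  Obs : Set
  Obs = Vec ℕ k

  -- A (deterministic, adaptive) cop strategy: given the observations of
  -- all previous rounds (most recent first), choose the k probed vertices
  -- (a multiset, as a vector; no adjacency restriction).
  Strategy : Set
  Strategy = List Obs → Vec Vertex k

  IsWalk : (ℕ → Vertex) → Set
  IsWalk R = ∀ t → Move (R t) (R (suc t))

  history : Strategy → (ℕ → Vertex) → ℕ → List Obs
  history σ R zero    = []
  history σ R (suc t) =
    Vec.map (λ u → dist u (R t)) (σ (history σ R t)) ∷ history σ R t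

  -- After round t (0-indexed, i.e. the (t+1)-st round) the robber is
  -- captured: every robber trajectory producing the same observations in
  -- rounds 0..t is at the same current vertex.
  CapturedAt : Strategy → (ℕ → Vertex) → ℕ → Set
  CapturedAt σ R t =
    ∀ (R' : ℕ → Vertex) → IsWalk R' →
      history σ R' (suc t) ≡ history σ R (suc t) → R' t ≈ R t

  -- k cops can guarantee capture within N rounds
  -- (i.e. capt_{ζ,k}(G) ≤ N, given k ≥ ζ(G)).
  CanCaptureWithin : ℕ → Set
  CanCaptureWithin N =
    Σ Strategy λ σ → ∀ (R : ℕ → Vertex) → IsWalk R →
      ∃[ t ] (t < N × CapturedAt σ R t)

-- The perfect m-ary tree of height h (Ulam–Harris labelling): a vertex is
-- the word of child indices on the path from the root, of length ≤ h.

TVertex : ℕ → ℕ → Set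
TVertex m h = Σ (List (Fin m)) λ w → length w ≤ h

lcp : ∀ {m} → List (Fin m) → List (Fin m) → ℕ
lcp []       _        = zero
lcp (_ ∷ _)  []       = zero
lcp (a ∷ u)  (b ∷ v) with a ≟ᶠ b
... | yes _ = suc (lcp u v)
... | no  _ = zero

-- tree distance: up from u to the last common ancestor, then down to v
treeDist : ∀ {m} → List (Fin m) → List (Fin m) → ℕ
treeDist u v = (length u ∸ lcp u v) + (length v ∸ lcp u v)

ChildOf : ∀ {m} → List (Fin m) → List (Fin m) → Set
ChildOf {m} v u = Σ (Fin m) λ i → v ≡ u ++ [ i ]

PerfectTree : ℕ → ℕ → Graph
PerfectTree m h = record
  { Vertex = TVertex m h
  ; _≈_    = λ u v → proj₁ u ≡ proj₁ v
  ; Move   = λ u v → (proj₁ u ≡ proj₁ v)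
                     ⊎ (ChildOf (proj₁ v) (proj₁ u) ⊎ ChildOf (proj₁ u) (proj₁ v))
  ; dist   = λ u v → treeDist (proj₁ u) (proj₁ v)
  }

{-# OPTIONS --safe #-}
module Submission where

-- The cops keep a lead (p , j): the robber is at p or below it, and its branch
-- below p does not start at one of the children of p probed in blocks before j.
-- Each round probes block j, i.e. the next k children of p.  Two distinct
-- children cannot both lie on the robber's branch, so the larger of their
-- distances is one more than the depth of the robber below p; if that depth is
-- 0 the robber is caught.  The child on the robber's branch is strictly closer
-- than every other child, so a hit lets the cops descend to it; after misses on
-- all of the children 0, …, m - 2 the branch must be the child m - 1.  The
-- robber cannot change branches without passing through p, where the next
-- round catches it.  So the potential |p| ⌈(m-1)/k⌉ + j grows in every round
-- without capture, and while the robber is free it stays below h ⌈(m-1)/k⌉.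

open import Defs
open import Data.Nat using (ℕ; zero; suc; _+_; _∸_; _*_; _⊔_; _<_; _≤_; z≤n; s≤s; z<s; _<?_; _≤?_)
open import Data.Nat.Properties
open import Data.Nat.DivMod using (_/_; m*n/n≡m; /-monoˡ-≤)
open import Data.Fin using (Fin; toℕ; fromℕ; fromℕ<; zero; suc)
open import Data.Fin.Properties using (toℕ-fromℕ; toℕ-fromℕ<; toℕ-injective; toℕ≤pred[n]; any?)
  renaming (_≟_ to _≟ᶠ_)
open import Data.List using (List; []; _∷_; length; _++_; [_])
open import Data.List.Properties using (length-++; ++-assoc; ++-identityʳ; ++-conicalʳ; ∷-injectiveˡ; ∷-injectiveʳ)
open import Data.Vec using (Vec; lookup; tabulate)
import Data.Vec as Vec
open import Data.Vec.Properties using (lookup-map; lookup∘tabulate)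
open import Data.Product using (Σ; ∃; _×_; _,_; proj₁; proj₂)
open import Data.Sum using (_⊎_; inj₁; inj₂)
open import Function using (_∘_)
open import Relation.Nullary using (¬_; Dec; yes; no; contradiction)
open import Relation.Unary using (Pred; Decidable)
open import Relation.Binary.PropositionalEquality
  using (_≡_; _≢_; refl; sym; trans; cong; cong₂; subst; module ≡-Reasoning)

clamp : ∀ n → ℕ → Fin (suc n)
clamp n x = fromℕ< (s≤s (m⊓n≤n x n))

toℕ-clamp : ∀ {n x} → x ≤ n → toℕ (clamp n x) ≡ x
toℕ-clamp x≤n = trans (toℕ-fromℕ< _) (m≤n⇒m⊓n≡m x≤n)

<-ceilDiv : ∀ j n k → j * suc k < n → j < ceilDiv n (suc k)
<-ceilDiv j n k j*k<n = begin
  suc j                       ≡⟨ m*n/n≡m (suc j) (suc k) ⟨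
  suc j * suc k / suc k       ≤⟨ /-monoˡ-≤ (suc k) [1+j]*k≤n+k ⟩
  ceilDiv n (suc k)           ∎
  where
  open ≤-Reasoning
  [1+j]*k≤n+k : suc j * suc k ≤ n + k
  [1+j]*k≤n+k = begin
    suc j * suc k             ≡⟨ +-suc k (j * suc k) ⟨
    k + suc (j * suc k)       ≤⟨ +-monoʳ-≤ k j*k<n ⟩
    k + n                     ≡⟨ +-comm k n ⟩
    n + k                     ∎

i*c+j<[1+i]*c : ∀ i {c j} → j < c → i * c + j < suc i * c
i*c+j<[1+i]*c i {c} {j} j<c = subst (i * c + j <_) (+-comm (i * c) c) (+-monoʳ-< (i * c) j<c)

found-below : ∀ {p} {P : Pred ℕ p} → Decidable P → ∀ {N} →
  (∀ t → (∀ {s} → s < t → ¬ P s) → t < N) → ∃ λ t → t < N × P t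
found-below P? {N} bounded with anyUpTo? P? N
... | yes found = found
... | no  none  = contradiction (bounded N (λ s<N Ps → none (_ , s<N , Ps))) (n≮n N)

module _ {a} {A : Set a} where

  length-<-++-∷ : ∀ (p : List A) {x w} → length p < length (p ++ x ∷ w)
  length-<-++-∷ p = subst (length p <_) (sym (length-++ p)) (m<m+n (length p) z<s)

  length-∷ʳ : ∀ x (p : List A) → length (p ++ [ x ]) ≡ suc (length p)
  length-∷ʳ x p = trans (length-++ p) (+-comm (length p) 1)

  parent-of-descendant : ∀ (p : List A) {x w u i} → u ++ [ i ] ≡ p ++ x ∷ w →
    u ≡ p ⊎ ∃ λ w′ → u ≡ p ++ x ∷ w′
  parent-of-descendant []      {u = []}     _ = inj₁ refl
  parent-of-descendant []      {u = y ∷ u}  e = inj₂ (u , cong (_∷ u) (∷-injectiveˡ e))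
  parent-of-descendant (y ∷ p) {u = []}     e with () ← ++-conicalʳ p _ (sym (∷-injectiveʳ e))
  parent-of-descendant (y ∷ p) {u = y′ ∷ u} e with parent-of-descendant p (∷-injectiveʳ e)
  ... | inj₁ u≡p        = inj₁ (cong₂ _∷_ (∷-injectiveˡ e) u≡p)
  ... | inj₂ (w′ , u≡p) = inj₂ (w′ , cong₂ _∷_ (∷-injectiveˡ e) u≡p)

module _ {m : ℕ} where

  lcp-++ : ∀ (p u w : List (Fin m)) → lcp (p ++ u) (p ++ w) ≡ length p + lcp u w
  lcp-++ []      u w = refl
  lcp-++ (x ∷ p) u w with x ≟ᶠ x
  ... | yes _  = cong suc (lcp-++ p u w)
  ... | no x≢x = contradiction refl x≢x

  treeDist-++ : ∀ (p u w : List (Fin m)) → treeDist (p ++ u) (p ++ w) ≡ treeDist u w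
  treeDist-++ p u w rewrite lcp-++ p u w | length-++ p {u} | length-++ p {w} =
    cong₂ _+_ ([m+n]∸[m+o]≡n∸o (length p) (length u) (lcp u w))
              ([m+n]∸[m+o]≡n∸o (length p) (length w) (lcp u w))

  treeDist-∷-≢ : ∀ {x y} (u w : List (Fin m)) → x ≢ y →
    treeDist (x ∷ u) (y ∷ w) ≡ suc (length u) + suc (length w)
  treeDist-∷-≢ {x} {y} u w x≢y with x ≟ᶠ y
  ... | yes x≡y = contradiction x≡y x≢y
  ... | no  _   = refl

module Hunt (m₀ k₀ h : ℕ) where

  m k c : ℕ
  m = 2 + m₀
  k = 2 + k₀
  c = ceilDiv (m ∸ 1) k

  Word : Set
  Word = List (Fin m)

  Lead : Set
  Lead = Word × ℕ

  data Verdict : Set where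
    caught  : Word → Verdict
    chasing : Lead → Verdict

  Caught : Verdict → Set
  Caught s = ∃ λ p → s ≡ caught p

  caught? : ∀ s → Dec (Caught s)
  caught? (caught p)  = yes (p , refl)
  caught? (chasing _) = no λ ()

  -- Indices beyond m - 1 are clamped to it, so the last block may repeat a child.
  child : ℕ → Fin k → Fin m
  child j q = clamp (m ∸ 1) (j * k + toℕ q)

  lastChild : Fin m
  lastChild = fromℕ (m ∸ 1)

  -- Words longer than h are sent to the root.
  vertex : Word → TVertex m h
  vertex w with length w ≤? h
  ... | yes w≤h = w , w≤h
  ... | no  _   = [] , z≤n

  probes : Lead → Vec (TVertex m h) k
  probes (p , j) = tabulate λ q → vertex (p ++ [ child j q ])

  observe : Lead → Word → Vec ℕ k
  observe ℓ v = Vec.map (λ u → treeDist (proj₁ u) v) (probes ℓ)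

  gap : Vec ℕ k → ℕ
  gap o = (lookup o zero ⊔ lookup o (suc zero)) ∸ 1

  settle : Word → ℕ → Verdict
  settle p zero    = caught p
  settle p (suc _) = chasing (p , 0)

  nextBlock : Lead → ℕ → Verdict
  nextBlock (p , j) r with suc j * k <? m ∸ 1
  ... | yes _ = chasing (p , suc j)
  ... | no  _ = settle (p ++ [ lastChild ]) r

  chase : Lead → Vec ℕ k → ℕ → Verdict
  chase (p , j) o r with any? (λ q → lookup o q ≤? r)
  ... | yes (q , _) = settle (p ++ [ child j q ]) r
  ... | no  _       = nextBlock (p , j) r

  round : Lead → Vec ℕ k → Verdict
  round (p , j) o with length p <? h | gap o
  ... | no  _ | _     = caught p
  ... | yes _ | zero  = caught p
  ... | yes _ | suc r = chase (p , j) o r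

  start : Lead
  start = [] , 0

  resume : Verdict → Lead
  resume (caught _)  = start
  resume (chasing ℓ) = ℓ

  open Game (PerfectTree m h) k

  lead : List Obs → Lead
  lead []       = start
  lead (o ∷ os) = resume (round (lead os) o)

  strategy : Strategy
  strategy = probes ∘ lead

  j<c : ∀ {j} → j * k < m ∸ 1 → j < c
  j<c {j} = <-ceilDiv j (m ∸ 1) (suc k₀)

  child₀≢child₁ : ∀ {j} → j * k < m ∸ 1 → child j zero ≢ child j (suc zero)
  child₀≢child₁ {j} jk e = 0≢1+n (+-cancelˡ-≡ (j * k) 0 1 (begin
    j * k + 0                 ≡⟨ toℕ-clamp (subst (_≤ m ∸ 1) (sym (+-identityʳ (j * k))) (<⇒≤ jk)) ⟨
    toℕ (child j zero)        ≡⟨ cong toℕ e ⟩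
    toℕ (child j (suc zero))  ≡⟨ toℕ-clamp (subst (_≤ m ∸ 1) (+-comm 1 (j * k)) jk) ⟩
    j * k + 1                 ∎))
    where open ≡-Reasoning

  child-onto : ∀ {j a} → j * k ≤ toℕ a → toℕ a < suc j * k → ∃ λ q → child j q ≡ a
  child-onto {j} {a} jk≤a a<[1+j]k = q , toℕ-injective (begin
    toℕ (child j q)           ≡⟨ toℕ-clamp (subst (_≤ m ∸ 1) (sym jk+q≡a) (toℕ≤pred[n] a)) ⟩
    j * k + toℕ q             ≡⟨ jk+q≡a ⟩
    toℕ a                     ∎)
    where
    open ≡-Reasoning
    r<k : toℕ a ∸ j * k < k
    r<k = m<n+o⇒m∸n<o (toℕ a) (j * k) (subst (toℕ a <_) (+-comm k (j * k)) a<[1+j]k)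
    q : Fin k
    q = fromℕ< r<k
    jk+q≡a : j * k + toℕ q ≡ toℕ a
    jk+q≡a = trans (cong (j * k +_) (toℕ-fromℕ< r<k)) (m+[n∸m]≡n jk≤a)

  block-missed : ∀ {j a} → j * k ≤ toℕ a → (∀ q → child j q ≢ a) → suc j * k ≤ toℕ a
  block-missed {j} {a} jk≤a miss with suc j * k ≤? toℕ a
  ... | yes next≤a = next≤a
  ... | no  next≰a = contradiction (proj₂ (child-onto {j} jk≤a (≰⇒> next≰a))) (miss _)

  lastChild-forced : ∀ {j a} → ¬ suc j * k < m ∸ 1 → suc j * k ≤ toℕ a → lastChild ≡ a
  lastChild-forced {j} {a} no-next next≤a = toℕ-injective (begin
    toℕ lastChild             ≡⟨ toℕ-fromℕ (m ∸ 1) ⟩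
    m ∸ 1                     ≡⟨ ≤-antisym (≤-trans (≮⇒≥ no-next) next≤a) (toℕ≤pred[n] a) ⟩
    toℕ a                     ∎)
    where open ≡-Reasoning

  -- A record rather than a function type, so that j, w and o can be inferred.
  record Observes (j : ℕ) (w : Word) (o : Vec ℕ k) : Set where
    constructor observes
    field distance : ∀ q → lookup o q ≡ treeDist [ child j q ] w
  open Observes

  proj₁-vertex : ∀ {w} → length w ≤ h → proj₁ (vertex w) ≡ w
  proj₁-vertex {w} w≤h with length w ≤? h
  ... | yes _   = refl
  ... | no  w≰h = contradiction w≤h w≰h

  observe-++ : ∀ {p j w} → length p < h → Observes j w (observe (p , j) (p ++ w))
  observe-++ {p} {j} {w} p<h = observes λ q → begin
    lookup (observe (p , j) (p ++ w)) q
      ≡⟨ lookup-map q _ (probes (p , j)) ⟩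
    treeDist (proj₁ (lookup (probes (p , j)) q)) (p ++ w)
      ≡⟨ cong (λ u → treeDist (proj₁ u) (p ++ w)) (lookup∘tabulate probe q) ⟩
    treeDist (proj₁ (probe q)) (p ++ w)
      ≡⟨ cong (λ u → treeDist u (p ++ w)) (proj₁-vertex {p ++ [ child j q ]} (probe≤h q)) ⟩
    treeDist (p ++ [ child j q ]) (p ++ w)
      ≡⟨ treeDist-++ p [ child j q ] w ⟩
    treeDist [ child j q ] w
      ∎
    where
    open ≡-Reasoning
    probe : Fin k → TVertex m h
    probe q = vertex (p ++ [ child j q ])
    probe≤h : ∀ q → length (p ++ [ child j q ]) ≤ h
    probe≤h q = subst (_≤ h) (sym (length-∷ʳ (child j q) p)) p<h

  observe-here : ∀ {p j} → length p < h → Observes j [] (observe (p , j) p)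
  observe-here {p} {j} p<h = subst (Observes j [] ∘ observe (p , j)) (++-identityʳ p) (observe-++ {p} {j} {[]} p<h)

  module _ {j a w o} (obs : Observes j (a ∷ w) o) where

    observed-on-path : ∀ {q} → child j q ≡ a → lookup o q ≡ length w
    observed-on-path {q} refl = trans (distance obs q) (treeDist-++ [ a ] [] w)

    observed-off-path : ∀ {q} → child j q ≢ a → lookup o q ≡ 2 + length w
    observed-off-path {q} x≢a = trans (distance obs q) (treeDist-∷-≢ [] w x≢a)

    observed-≤ : ∀ q → lookup o q ≤ 2 + length w
    observed-≤ q with child j q ≟ᶠ a
    ... | yes x≡a = ≤-trans (≤-reflexive (observed-on-path x≡a)) (m≤n+m (length w) 2)
    ... | no  x≢a = ≤-reflexive (observed-off-path x≢a)

    gap-below : j * k < m ∸ 1 → gap o ≡ suc (length w)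
    gap-below jk = cong (_∸ 1) farther
      where
      farther : lookup o zero ⊔ lookup o (suc zero) ≡ 2 + length w
      farther with child j zero ≟ᶠ a
      ... | yes x₀≡a = trans
        (cong₂ _⊔_ (observed-on-path x₀≡a)
                   (observed-off-path λ x₁≡a → child₀≢child₁ {j} jk (trans x₀≡a (sym x₁≡a))))
        (m≤n⇒m⊔n≡n (m≤n+m (length w) 2))
      ... | no  x₀≢a = trans (cong (_⊔ lookup o (suc zero)) (observed-off-path x₀≢a))
                             (m≥n⇒m⊔n≡m (observed-≤ (suc zero)))

  gap-here : ∀ {j o} → Observes j [] o → gap o ≡ 0
  gap-here obs = cong (λ d → d ∸ 1) (cong₂ _⊔_ (distance obs zero) (distance obs (suc zero)))

  μ : Lead → ℕ
  μ (p , j) = length p * c + j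

  μ-nextBlock : ∀ {p j} → μ (p , j) < μ (p , suc j)
  μ-nextBlock {p} {j} = +-monoʳ-< (length p * c) (n<1+n j)

  μ-descend : ∀ {p j x} → j < c → μ (p , j) < μ (p ++ [ x ] , 0)
  μ-descend {p} {j} {x} j<c = begin-strict
    length p * c + j          <⟨ i*c+j<[1+i]*c (length p) j<c ⟩
    suc (length p) * c        ≡⟨ cong (_* c) (length-∷ʳ x p) ⟨
    length (p ++ [ x ]) * c   ≡⟨ +-identityʳ _ ⟨
    μ (p ++ [ x ] , 0)        ∎
    where open ≤-Reasoning

  μ-bounded : ∀ {p j} → j < c → length p < h → μ (p , j) < h * c
  μ-bounded {p} j<c p<h = <-≤-trans (i*c+j<[1+i]*c (length p) j<c) (*-monoˡ-≤ c p<h)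

  Below : ℕ → Word → Word → Set
  Below n p v = Σ (Fin m) λ a → Σ Word λ w → v ≡ p ++ a ∷ w × n ≤ toℕ a

  Hides : Lead → Word → Set
  Hides (p , j) v = j * k < m ∸ 1 × (v ≡ p ⊎ Below (j * k) p v)

  Sound : Lead → Verdict → Word → Set
  Sound ℓ (caught p)        v = v ≡ p
  Sound ℓ (chasing (p , j)) v = j * k < m ∸ 1 × Below (j * k) p v × μ ℓ < μ (p , j)

  hides-start : ∀ v → Hides start v
  hides-start []      = z<s , inj₁ refl
  hides-start (a ∷ w) = z<s , inj₂ (a , w , refl , z≤n)

  settle-sound : ∀ {ℓ p x a w} → x ≡ a → μ ℓ < μ (p ++ [ x ] , 0) →
    Sound ℓ (settle (p ++ [ x ]) (length w)) (p ++ a ∷ w)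
  settle-sound {w = []}    refl _      = refl
  settle-sound {p = p} {x} {w = b ∷ w} refl μ<μ′ =
    z<s , (b , w , sym (++-assoc p [ x ] (b ∷ w)) , z≤n) , μ<μ′

  nextBlock-sound : ∀ {p j a w} → j * k < m ∸ 1 → suc j * k ≤ toℕ a →
    Sound (p , j) (nextBlock (p , j) (length w)) (p ++ a ∷ w)
  nextBlock-sound {p} {j} {a} {w} jk next≤a with suc j * k <? m ∸ 1
  ... | yes jk′    = jk′ , (a , w , refl , next≤a) , μ-nextBlock {p}
  ... | no  no-next = settle-sound (lastChild-forced {j} no-next next≤a) (μ-descend {p} (j<c {j} jk))

  chase-sound : ∀ {p j a w o} → j * k < m ∸ 1 → j * k ≤ toℕ a → Observes j (a ∷ w) o →
    Sound (p , j) (chase (p , j) o (length w)) (p ++ a ∷ w)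
  chase-sound {p} {j} {a} {w} {o} jk jk≤a obs with any? (λ q → lookup o q ≤? length w)
  ... | yes (q , hit) = settle-sound on-path (μ-descend {p} (j<c {j} jk))
    where
    on-path : child j q ≡ a
    on-path with child j q ≟ᶠ a
    ... | yes x≡a = x≡a
    ... | no  x≢a = contradiction (subst (_≤ length w) (observed-off-path obs x≢a) hit) (m+n≮n 1 (length w))
  ... | no  miss = nextBlock-sound {p} jk (block-missed {j} jk≤a λ q x≡a →
                     miss (q , ≤-reflexive (observed-on-path obs x≡a)))

  round-sound-here : ∀ {p j} → Sound (p , j) (round (p , j) (observe (p , j) p)) p
  round-sound-here {p} {j} with length p <? h | gap (observe (p , j) p) in eq
  ... | no  _   | _     = refl
  ... | yes _   | zero  = refl
  ... | yes p<h | suc _ = contradiction (trans (sym eq) (gap-here (observe-here {p} {j} p<h))) λ ()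

  round-sound-below : ∀ {p j a w} → length (p ++ a ∷ w) ≤ h → j * k < m ∸ 1 → j * k ≤ toℕ a →
    Sound (p , j) (round (p , j) (observe (p , j) (p ++ a ∷ w))) (p ++ a ∷ w)
  round-sound-below {p} {j} {a} {w} v≤h jk jk≤a
    with length p <? h | gap (observe (p , j) (p ++ a ∷ w)) in eq
  ... | no  p≮h | _     = contradiction (<-≤-trans (length-<-++-∷ p) v≤h) p≮h
  ... | yes p<h | zero  = contradiction (trans (sym eq) (gap-below (observe-++ {p} {j} {a ∷ w} p<h) jk)) 0≢1+n
  ... | yes p<h | suc r with suc-injective (trans (sym eq) (gap-below (observe-++ {p} {j} {a ∷ w} p<h) jk))
  ...   | refl = chase-sound jk jk≤a (observe-++ {p} {j} {a ∷ w} p<h)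

  round-sound : ∀ {ℓ v} → length v ≤ h → Hides ℓ v → Sound ℓ (round ℓ (observe ℓ v)) v
  round-sound _   (_  , inj₁ refl)                   = round-sound-here
  round-sound v≤h (jk , inj₂ (a , w , refl , jk≤a)) = round-sound-below v≤h jk jk≤a

  Step : Word → Word → Set
  Step v v′ = v ≡ v′ ⊎ (ChildOf v′ v ⊎ ChildOf v v′)

  below-step : ∀ {n p v v′} → Below n p v → Step v v′ → v′ ≡ p ⊎ Below n p v′
  below-step below (inj₁ refl) = inj₂ below
  below-step {p = p} (a , w , refl , n≤a) (inj₂ (inj₁ (i , refl))) =
    inj₂ (a , w ++ [ i ] , ++-assoc p (a ∷ w) [ i ] , n≤a)
  below-step {p = p} (a , w , refl , n≤a) (inj₂ (inj₂ (i , e))) with parent-of-descendant p (sym e)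
  ... | inj₁ v′≡p        = inj₁ v′≡p
  ... | inj₂ (w′ , v′≡) = inj₂ (a , w′ , v′≡ , n≤a)

  sound-step : ∀ {ℓ s v v′} → Sound ℓ s v → Step v v′ → Hides (resume s) v′
  sound-step {s = caught _}  {v′ = v′} _ _ = hides-start v′
  sound-step {s = chasing _} (jk , below , _) st = jk , below-step below st

  sound-advances : ∀ {ℓ s v} → Sound ℓ s v → ¬ Caught s → μ ℓ < μ (resume s)
  sound-advances {s = caught p}  _               ¬caught = contradiction (p , refl) ¬caught
  sound-advances {s = chasing _} (_ , _ , μ<μ′) _       = μ<μ′

  sound-bounded : ∀ {ℓ s v} → Sound ℓ s v → ¬ Caught s → length v ≤ h → μ (resume s) < h * c
  sound-bounded {s = caught p} _ ¬caught _ = contradiction (p , refl) ¬caught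
  sound-bounded {s = chasing (p , j)} (jk , (_ , _ , refl , _) , _) _ v≤h =
    μ-bounded {p} (j<c {j} jk) (<-≤-trans (length-<-++-∷ p) v≤h)

  module Run (R : ℕ → TVertex m h) (walk : IsWalk R) where

    position : ℕ → Word
    position t = proj₁ (R t)

    leadAt : ℕ → Lead
    leadAt t = lead (history strategy R t)

    verdict : ℕ → Verdict
    verdict t = round (leadAt t) (observe (leadAt t) (position t))

    hides : ∀ t → Hides (leadAt t) (position t)
    sound : ∀ t → Sound (leadAt t) (verdict t) (position t)
    hides zero    = hides-start (position 0)
    hides (suc t) = sound-step (sound t) (walk t)
    sound t       = round-sound (proj₂ (R t)) (hides t)

    rounds-≤-μ : ∀ t → (∀ {s} → s < t → ¬ Caught (verdict s)) → t ≤ μ (leadAt t)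
    rounds-≤-μ zero    _    = z≤n
    rounds-≤-μ (suc t) free =
      ≤-<-trans (rounds-≤-μ t (free ∘ m<n⇒m<1+n)) (sound-advances (sound t) (free ≤-refl))

    rounds-< : 1 ≤ h → ∀ t → (∀ {s} → s < t → ¬ Caught (verdict s)) → t < h * c
    rounds-< 1≤h zero    _    = *-mono-≤ 1≤h (j<c z<s)
    rounds-< _   (suc t) free =
      ≤-<-trans (rounds-≤-μ (suc t) free) (sound-bounded (sound t) (free ≤-refl) (proj₂ (R t)))

  caught-position : ∀ {ℓ s v p} → Sound ℓ s v → s ≡ caught p → v ≡ p
  caught-position v≡p refl = v≡p

  caught-captures : ∀ R walk t → Caught (Run.verdict R walk t) → CapturedAt strategy R t
  caught-captures R walk t (p , verdict≡) R′ walk′ same =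
    trans (caught-position (Run.sound R′ walk′ t) (trans same-verdict verdict≡))
          (sym (caught-position (Run.sound R walk t) verdict≡))
    where
    same-verdict : Run.verdict R′ walk′ t ≡ Run.verdict R walk t
    same-verdict = cong₂ (λ o os → round (lead os) o) (∷-injectiveˡ same) (∷-injectiveʳ same)

  captures-within : 1 ≤ h → CanCaptureWithin (h * c)
  captures-within 1≤h = strategy , λ R walk →
    let t , t<hc , caught-t = found-below (caught? ∘ Run.verdict R walk) (Run.rounds-< R walk 1≤h)
    in  t , t<hc , caught-captures R walk t caught-t

mainTheorem8 : (m h k : ℕ) → 2 ≤ m → 1 ≤ h → 2 ≤ k →
    Game.CanCaptureWithin (PerfectTree m h) k (h * ceilDiv (m ∸ 1) k)
mainTheorem8 (suc (suc m₀)) h (suc (suc k₀)) _ 1≤h _ = Hunt.captures-within m₀ k₀ h 1≤h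
mainTheorem8 0             _ _             () _ _
mainTheorem8 1             _ _             (s≤s ()) _ _
mainTheorem8 (suc (suc _)) _ 0             _ _ ()
mainTheorem8 (suc (suc _)) _ 1             _ _ (s≤s ())
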